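{- Let $b,c$ be integers with $b\ge c\ge 2$. (i) If $W$ is a base-$b$ word and $\mathrm{ot}(W)$ is an ordinal, then there is a base-$c$ word $V$ such that $\mathrm{ot}(V)$ is an ordinal and $\mathrm{ot}(W)\preceq\mathrm{ot}(V)$. (ii) If $V$ is a base-$c$ word, then there is a base-$b$ word $W$ with $\mathrm{ot}(W)\simeq\mathrm{ot}(V)$.
   Context: A word is an infinite sequence $W=w_0w_1w_2\cdots$ with $w_k\in\mathbb{N}$; it is a base-$b$ word if $0\le w_k<b$ for all $k$. Words are ordered lexicographically: $W<V$ if, for $i$ the least index with $w_i\ne v_i$, we have $w_i<v_i$. The shift map is $\sigma(w_0w_1w_2\cdots)=w_1w_2w_3\cdots$, and $\mathrm{ot}(W)$ denotes the order type of the linearly ordered set $\{\sigma^k(W):k\in\mathbb{N}\}$; "$\mathrm{ot}(W)$ is an ordinal" means this set is well-ordered. $\beta\preceq\gamma$ means order type $\beta$ order-embeds into order type $\gamma$ (the usual $\le$ for ordinals), and $\simeq$ means equal order type. -}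

module Defs where

open import Data.Nat using (ℕ; _+_; _<_)
open import Data.Product using (Σ; ∃; _×_)
open import Relation.Binary.PropositionalEquality using (_≡_)
open import Induction.WellFounded using (WellFounded)

Word : Set
Word = ℕ → ℕ

BaseWord : ℕ → Word → Set
BaseWord b W = ∀ k → W k < b

_≈w_ : Word → Word → Set
W ≈w V = ∀ i → W i ≡ V i

_<w_ : Word → Word → Set
W <w V = ∃ λ i → (∀ j → j < i → W j ≡ V j) × W i < V i

shift : ℕ → Word → Word
shift k W n = W (k + n)

-- The linearly ordered set {σ^k(W) : k ∈ ℕ}, presented via indices k:
-- the element σ^k(W) is represented by k; equality/order are those of the words.
_<[_]_ : ℕ → Word → ℕ → Set
k <[ W ] m = shift k W <w shift m W

_≈[_]_ : ℕ → Word → ℕ → Set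
k ≈[ W ] m = shift k W ≈w shift m W

IsOrdinal : Word → Set
IsOrdinal W = WellFounded (λ k m → k <[ W ] m)

record OrderEmbedding (W V : Word) : Set where
  field
    map       : ℕ → ℕ
    resp-≈    : ∀ k m → k ≈[ W ] m → map k ≈[ V ] map m
    pres-<    : ∀ k m → k <[ W ] m → map k <[ V ] map m
    refl-<    : ∀ k m → map k <[ V ] map m → k <[ W ] m

_⪯ot_ : Word → Word → Set
W ⪯ot V = OrderEmbedding W V

_≃ot_ : Word → Word → Set
W ≃ot V = Σ (OrderEmbedding W V) λ e →
  ∀ m → ∃ λ k → OrderEmbedding.map e k ≈[ V ] m

-- Write a word w₀ w₁ w₂ ⋯ in unary, as the binary word 1^w₀ 0 1^w₁ 0 1^w₂ 0 ⋯.
-- Reading a code letter by letter compares first the number of leading 1s and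
-- then the codes of the tails, so the code preserves and reflects the
-- lexicographic order.  Every suffix of the code of W is the code of a word
-- m ∷ σᵏ(W); the suffixes are therefore ordered lexicographically by the pairs
-- (m , σᵏ(W)), and are well-ordered when ot(W) is an ordinal.  Sending σᵏ(W)
-- to the suffix that starts at the k-th block embeds ot(W) into ot of the code.
-- Nothing here uses a bound on the letters of W, and (ii) is immediate because
-- a base-c word is a base-b word.
module Submission where

open import Defs
open import Data.Nat using (ℕ; zero; suc; _+_; _≤_; _<_; z<s; s<s)
open import Data.Nat.Properties
  using (<-cmp; <-irrefl; <-asym; <-trans; <-≤-trans; m<n⇒m<1+n; m<1+n⇒m<n∨m≡n; +-assoc)
open import Data.Nat.Induction using (<-wellFounded)
open import Data.Product using (∃; ∃₂; _×_; _,_; proj₂)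
open import Data.Product.Relation.Binary.Lex.Strict using (×-Lex; ×-wellFounded)
open import Data.Sum using (_⊎_; inj₁; inj₂)
open import Relation.Binary.Definitions using (tri<; tri≈; tri>)
open import Relation.Binary.PropositionalEquality
  using (_≡_; refl; sym; trans; cong; subst; subst₂)
open import Relation.Binary.Construct.On as On using ()
open import Relation.Nullary using (¬_; contradiction)
open import Induction.WellFounded using (module Subrelation)

private
  variable
    X Y X′ Y′ : Word

≈w-sym : X ≈w Y → Y ≈w X
≈w-sym X≈Y i = sym (X≈Y i)

≈w-trans : X ≈w Y → Y ≈w Y′ → X ≈w Y′
≈w-trans X≈Y Y≈Y′ i = trans (X≈Y i) (Y≈Y′ i)

_∷w_ : ℕ → Word → Word
(m ∷w X) zero    = m
(m ∷w X) (suc i) = X i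

shift-cong : ∀ n → X ≈w Y → shift n X ≈w shift n Y
shift-cong n X≈Y i = X≈Y (n + i)

shift-+ : ∀ m n X → shift (m + n) X ≈w shift n (shift m X)
shift-+ m n X i = cong X (+-assoc m n i)

AgreeBelow : ℕ → Word → Word → Set
AgreeBelow n X Y = ∀ j → j < n → X j ≡ Y j

<w-resp-≈w : X ≈w X′ → Y ≈w Y′ → X <w Y → X′ <w Y′
<w-resp-≈w X≈X′ Y≈Y′ (i , agree , lt) =
  i , (λ j j<i → trans (sym (X≈X′ j)) (trans (agree j j<i) (Y≈Y′ j)))
    , subst₂ _<_ (X≈X′ i) (Y≈Y′ i) lt

<w-asym : X <w Y → ¬ Y <w X
<w-asym (i , agree , lt) (i′ , agree′ , lt′) with <-cmp i i′
... | tri< i<i′ _ _ = <-irrefl (sym (agree′ i i<i′)) lt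
... | tri≈ _ refl _ = <-asym lt lt′
... | tri> _ _ i′<i = <-irrefl (sym (agree i′ i′<i)) lt′

<w-trichotomy-below : ∀ n X Y → AgreeBelow n X Y ⊎ X <w Y ⊎ Y <w X
<w-trichotomy-below zero X Y = inj₁ (λ _ ())
<w-trichotomy-below (suc n) X Y with <w-trichotomy-below n X Y
... | inj₂ ordered = inj₂ ordered
... | inj₁ agree with <-cmp (X n) (Y n)
...   | tri< lt _ _ = inj₂ (inj₁ (n , agree , lt))
...   | tri> _ _ gt = inj₂ (inj₂ (n , (λ j j<n → sym (agree j j<n)) , gt))
...   | tri≈ _ eq _ = inj₁ agree′
  where
  agree′ : AgreeBelow (suc n) X Y
  agree′ j j<1+n with m<1+n⇒m<n∨m≡n j<1+n
  ... | inj₁ j<n  = agree j j<n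
  ... | inj₂ refl = eq

<w-cons : X 0 ≡ Y 0 → shift 1 X <w shift 1 Y → X <w Y
<w-cons head≡ (i , agree , lt) =
  suc i , (λ { zero _ → head≡ ; (suc j) (s<s j<i) → agree j j<i }) , lt

<w-uncons : X <w Y → X 0 < Y 0 ⊎ (X 0 ≡ Y 0 × shift 1 X <w shift 1 Y)
<w-uncons (zero  , _     , lt) = inj₁ lt
<w-uncons (suc i , agree , lt) =
  inj₂ (agree 0 z<s , i , (λ j j<i → agree (suc j) (s<s j<i)) , lt)

-- unary∷ m Y is 1^m 0 followed by unary Y, that is, the code of m ∷w Y.
unary∷ : ℕ → Word → Word
unary∷ zero    Y zero    = 0
unary∷ (suc m) Y zero    = 1
unary∷ (suc m) Y (suc n) = unary∷ m Y n
unary∷ zero    Y (suc n) = unary∷ (Y 0) (shift 1 Y) n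

unary : Word → Word
unary X = unary∷ (X 0) (shift 1 X)

unary∷-binary : ∀ m Y → BaseWord 2 (unary∷ m Y)
unary∷-binary zero    Y zero    = z<s
unary∷-binary (suc m) Y zero    = s<s z<s
unary∷-binary (suc m) Y (suc n) = unary∷-binary m Y n
unary∷-binary zero    Y (suc n) = unary∷-binary (Y 0) (shift 1 Y) n

unary-binary : ∀ X → BaseWord 2 (unary X)
unary-binary X = unary∷-binary (X 0) (shift 1 X)

unary∷-ones : ∀ m Y {j} → j < m → unary∷ m Y j ≡ 1
unary∷-ones (suc m) Y {zero}  _         = refl
unary∷-ones (suc m) Y {suc j} (s<s j<m) = unary∷-ones m Y j<m

unary∷-zero : ∀ m Y → unary∷ m Y m ≡ 0
unary∷-zero zero    Y = refl
unary∷-zero (suc m) Y = unary∷-zero m Y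

-- The block of Yᵢ starts after at least i + 1 code letters, so the j-th code
-- letter depends only on Y below j.
unary∷-agree : ∀ m j → AgreeBelow j Y Y′ → unary∷ m Y j ≡ unary∷ m Y′ j
unary∷-agree zero    zero    _     = refl
unary∷-agree (suc m) zero    _     = refl
unary∷-agree (suc m) (suc j) agree = unary∷-agree m j (λ k k<j → agree k (m<n⇒m<1+n k<j))
unary∷-agree {Y} {Y′} zero (suc j) agree =
  trans (cong (λ m → unary∷ m (shift 1 Y) j) (agree 0 z<s))
        (unary∷-agree (Y′ 0) j (λ k k<j → agree (suc k) (s<s k<j)))

unary-agree : ∀ {n} → AgreeBelow (suc n) X Y → unary X n ≡ unary Y n
unary-agree {n = n} = unary∷-agree zero (suc n)

unary-cong : X ≈w Y → unary X ≈w unary Y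
unary-cong X≈Y n = unary-agree (λ j _ → X≈Y j)

unary∷-monoˡ : ∀ {m m′} → m < m′ → unary∷ m Y <w unary∷ m′ Y′
unary∷-monoˡ {Y} {Y′} {m} {m′} m<m′ =
  m , (λ j j<m → trans (unary∷-ones m Y j<m)
                        (sym (unary∷-ones m′ Y′ (<-trans j<m m<m′))))
    , subst₂ _<_ (sym (unary∷-zero m Y)) (sym (unary∷-ones m′ Y′ m<m′)) z<s

unary∷-monoʳ : ∀ m → unary Y <w unary Y′ → unary∷ m Y <w unary∷ m Y′
unary∷-monoʳ zero    lt = <w-cons refl lt
unary∷-monoʳ (suc m) lt = <w-cons refl (unary∷-monoʳ m lt)

unary-mono : X <w Y → unary X <w unary Y
unary-mono (i , agree , lt) = go i agree lt
  where
  go : ∀ i {X Y} → AgreeBelow i X Y → X i < Y i → unary X <w unary Y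
  go zero    _ X₀<Y₀ = unary∷-monoˡ X₀<Y₀
  go (suc i) {X} {Y} agree lt =
    subst (λ m → unary X <w unary∷ m (shift 1 Y)) (agree 0 z<s)
          (unary∷-monoʳ (X 0) (go i (λ j j<i → agree (suc j) (s<s j<i)) lt))

unary-reflects : unary X <w unary Y → X <w Y
unary-reflects {X} {Y} ux<uy@(n , _ , lt) with <w-trichotomy-below (suc n) X Y
... | inj₁ agree        = contradiction (unary-agree agree) (λ eq → <-irrefl eq lt)
... | inj₂ (inj₁ X<Y) = X<Y
... | inj₂ (inj₂ Y<X) = contradiction (unary-mono Y<X) (<w-asym ux<uy)

shift-unary∷ : ∀ m Y → shift (suc m) (unary∷ m Y) ≈w unary Y
shift-unary∷ zero    Y _ = refl
shift-unary∷ (suc m) Y   = shift-unary∷ m Y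

shift-unary∷-form : ∀ n m Y → ∃₂ λ m′ k → shift n (unary∷ m Y) ≈w unary∷ m′ (shift k Y)
shift-unary∷-form zero    m       Y = m , 0 , λ _ → refl
shift-unary∷-form (suc n) (suc m) Y = shift-unary∷-form n m Y
shift-unary∷-form (suc n) zero    Y with shift-unary∷-form n (Y 0) (shift 1 Y)
... | m′ , k , eq = m′ , suc k , eq

shift-unary-form : ∀ n X → ∃₂ λ m k → shift n (unary X) ≈w unary (m ∷w shift k X)
shift-unary-form n X =
  let m , k , eq = shift-unary∷-form n (X 0) (shift 1 X) in m , suc k , eq

blockStart : Word → ℕ → ℕ
blockStart X zero    = 0
blockStart X (suc k) = suc (X 0) + blockStart (shift 1 X) k

shift-blockStart : ∀ k X → shift (blockStart X k) (unary X) ≈w unary (shift k X)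
shift-blockStart zero    X _ = refl
shift-blockStart (suc k) X =
  ≈w-trans (shift-+ (suc (X 0)) (blockStart (shift 1 X) k) (unary X))
  (≈w-trans (shift-cong (blockStart (shift 1 X) k) (shift-unary∷ (X 0) (shift 1 X)))
            (shift-blockStart k (shift 1 X)))

unary-isOrdinal : IsOrdinal X → IsOrdinal (unary X)
unary-isOrdinal {X} wfX =
  Subrelation.wellFounded suffix-lex
    (On.wellFounded suffix (×-wellFounded <-wellFounded wfX))
  where
  suffix : ℕ → ℕ × ℕ
  suffix n = let m , k , _ = shift-unary-form n X in m , k

  suffix-spec : ∀ n → let m , k = suffix n in shift n (unary X) ≈w unary (m ∷w shift k X)
  suffix-spec n = proj₂ (proj₂ (shift-unary-form n X))

  suffix-lex : ∀ {n n′} → n <[ unary X ] n′ →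
               ×-Lex _≡_ _<_ (λ k k′ → k <[ X ] k′) (suffix n) (suffix n′)
  suffix-lex {n} {n′} lt =
    let m , k = suffix n; m′ , k′ = suffix n′
    in <w-uncons (unary-reflects {m ∷w shift k X} {m′ ∷w shift k′ X}
                   (<w-resp-≈w (suffix-spec n) (suffix-spec n′) lt))

unary-embedding : (X : Word) → X ⪯ot unary X
unary-embedding X = record
  { map    = blockStart X
  ; resp-≈ = λ k k′ eq →
      ≈w-trans (shift-blockStart k X)
        (≈w-trans (unary-cong {shift k X} {shift k′ X} eq) (≈w-sym (shift-blockStart k′ X)))
  ; pres-< = λ k k′ lt →
      <w-resp-≈w (≈w-sym (shift-blockStart k X)) (≈w-sym (shift-blockStart k′ X))
        (unary-mono lt)
  ; refl-< = λ k k′ lt →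
      unary-reflects {shift k X} {shift k′ X}
        (<w-resp-≈w (shift-blockStart k X) (shift-blockStart k′ X) lt)
  }

≃ot-refl : (X : Word) → X ≃ot X
≃ot-refl X =
    record { map = λ k → k ; resp-≈ = λ _ _ eq → eq ; pres-< = λ _ _ lt → lt ; refl-< = λ _ _ lt → lt }
  , λ k → k , λ _ → refl

BaseWord-mono : ∀ {b c} → b ≤ c → BaseWord b X → BaseWord c X
BaseWord-mono b≤c baseX k = <-≤-trans (baseX k) b≤c

lemma5 : (b c : ℕ) → 2 ≤ c → c ≤ b →
    ((W : Word) → BaseWord b W → IsOrdinal W →
       ∃ λ V → BaseWord c V × IsOrdinal V × (W ⪯ot V))
    × ((V : Word) → BaseWord c V →
       ∃ λ W → BaseWord b W × (W ≃ot V))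
lemma5 b c 2≤c c≤b =
    (λ W _ wfW →
       unary W , BaseWord-mono 2≤c (unary-binary W) , unary-isOrdinal {W} wfW , unary-embedding W)
  , (λ V baseV → V , BaseWord-mono c≤b baseV , ≃ot-refl V)
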